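{- Let $\mathcal{T}$ be a binary compacted trie (every internal node has exactly two children, a left child reached by branching bit $0$ and a right child reached by branching bit $1$). For an internal node $u$, its left-biased heavy child is the child whose subtrie has strictly more leaves, or the left child if both subtries have the same number of leaves. Then every path that starts at an internal node of $\mathcal{T}$ and repeatedly moves to the left-biased heavy child until reaching a leaf ends with a left turn (its last edge goes to a left child). Consequently, in the path decomposition of $\mathcal{T}$ obtained by always choosing left-biased heavy paths, every internal node of the path decomposition tree has at least one right child.
   Context: A path decomposition $\mathcal{T}^c$ of a trie $\mathcal{T}$ is defined recursively: a root-to-leaf path of $\mathcal{T}$ is chosen and becomes the root of $\mathcal{T}^c$; the same procedure is applied recursively to each subtrie hanging off the chosen path, and the resulting trees become the children of the root. Here the chosen path is always the left-biased heavy path. A child of a node of $\mathcal{T}^c$ is called a left child if it corresponds to a subtrie hanging off the left side of the chosen path (i.e. the path went right at that point, leaving the left child's subtrie), and a right child if it corresponds to a subtrie hanging off the right side of the path. -}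

module Defs where

open import Data.Nat using (ℕ; _+_; _<?_)
open import Data.Bool using (if_then_else_)
open import Data.List using (List; []; _∷_; last)
open import Data.Product using (_×_; _,_; proj₁)
open import Data.Maybe using (Maybe)
open import Relation.Nullary.Decidable using (⌊_⌋)
open import Data.List.Membership.Propositional using (_∈_)

-- Shape of a binary compacted trie: every internal node has exactly two
-- children, the left one (branching bit 0) and the right one (bit 1).
-- Edge labels (compacted strings) play no role in the statement.
data Trie : Set where
  leaf : Trie
  node : (l r : Trie) → Trie

leaves : Trie → ℕ
leaves leaf       = 1
leaves (node l r) = leaves l + leaves r

data Side : Set where
  left right : Side

data Internal : Trie → Set where
  internal : ∀ l r → Internal (node l r)

-- u ⊑ T : u is (the subtrie rooted at) a node of T
data _⊑_ : Trie → Trie → Set where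
  here  : ∀ {t} → t ⊑ t
  inL   : ∀ {u l r} → u ⊑ l → u ⊑ node l r
  inR   : ∀ {u l r} → u ⊑ r → u ⊑ node l r

heavyPath : Trie → List Side
heavyPath leaf       = []
heavyPath (node l r) =
  if ⌊ leaves l <? leaves r ⌋ then right ∷ heavyPath r else left ∷ heavyPath l

data PD : Set where
  pd : List (Side × PD) → PD

children : PD → List (Side × PD)
children (pd cs) = cs

mutual
  decomp : Trie → PD
  decomp t = pd (hanging t)

  -- subtries hanging off the heavy path starting at t, with their side
  hanging : Trie → List (Side × PD)
  hanging leaf       = []
  hanging (node l r) =
    if ⌊ leaves l <? leaves r ⌋
    then (left , decomp l) ∷ hanging r
    else (right , decomp r) ∷ hanging l

data _∈PD_ : PD → PD → Set where
  here  : ∀ {p} → p ∈PD p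
  child : ∀ {p q cs} {s : Side} → (s , q) ∈ cs → p ∈PD q → p ∈PD pd cs

module Submission where

-- Both parts rest on one observation: every trie has at least one leaf, so
-- no subtrie is strictly lighter than a single leaf.  Hence if the heavy
-- path turns right at a node, the right child has at least two leaves and is
-- therefore internal; the path cannot end with that right turn.
--
-- Part 1 follows by induction on the node: the last turn of the path from
-- node l r is either the turn at this node (only possible when it goes left
-- to a leaf) or the last turn of the path from the internal heavy child.
-- Part 2: every node of the decomposition tree is itself the decomposition of
-- some trie t, whose children are the subtries hanging off the heavy path of
-- t.  For internal t, walk that path: at the first left turn the right child
-- hangs off as a right child, and a left turn must occur since the path
-- cannot end with a right turn.

open import Defs
open import Data.List using (List; []; _∷_; last)
open import Data.List.Relation.Unary.Any using (Any; here; there)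
open import Data.List.Membership.Propositional using (_∈_)
open import Data.Maybe using (just)
open import Data.Product using (_×_; _,_; proj₁; ∃)
open import Data.Nat using (_<_; _<?_)
open import Data.Nat.Properties using (n<1⇒n≡0; m+n≡0⇒m≡0)
open import Data.Empty using (⊥-elim)
open import Relation.Nullary using (¬_; yes; no)
open import Relation.Binary.PropositionalEquality using (_≡_; _≢_; refl)

last-∷ : ∀ {A : Set} (x : A) {a : A} (xs : List A) →
         last xs ≡ just a → last (x ∷ xs) ≡ just a
last-∷ x []       ()
last-∷ x (y ∷ ys) eq = eq

leaves≢0 : ∀ t → leaves t ≢ 0
leaves≢0 leaf       ()
leaves≢0 (node l r) eq = leaves≢0 l (m+n≡0⇒m≡0 (leaves l) eq)

-- Hence no trie is strictly lighter than a single leaf: when the heavy path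
-- turns right, the right child is internal.
¬lighter-than-leaf : ∀ t → ¬ (leaves t < leaves leaf)
¬lighter-than-leaf t lt = leaves≢0 t (n<1⇒n≡0 lt)

heavyPath-ends-left : ∀ l r → last (heavyPath (node l r)) ≡ just left
heavyPath-ends-left l r with leaves l <? leaves r
heavyPath-ends-left l leaf       | yes lt = ⊥-elim (¬lighter-than-leaf l lt)
heavyPath-ends-left l (node a b) | yes _ =
  last-∷ right (heavyPath (node a b)) (heavyPath-ends-left a b)
heavyPath-ends-left leaf       r | no _ = refl
heavyPath-ends-left (node a b) r | no _ =
  last-∷ left (heavyPath (node a b)) (heavyPath-ends-left a b)

IsRight : Side × PD → Set
IsRight c = proj₁ c ≡ right

hanging-has-right : ∀ l r → Any IsRight (hanging (node l r))
hanging-has-right l r with leaves l <? leaves r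
hanging-has-right l leaf       | yes lt = ⊥-elim (¬lighter-than-leaf l lt)
hanging-has-right l (node a b) | yes _  = there (hanging-has-right a b)
hanging-has-right l r          | no _   = here refl

IsDecomp : PD → Set
IsDecomp p = ∃ λ t → p ≡ decomp t

hanging-decomp : ∀ t {s q} → (s , q) ∈ hanging t → IsDecomp q
hanging-decomp leaf ()
hanging-decomp (node l r) m with leaves l <? leaves r
hanging-decomp (node l r) (here refl) | yes _ = l , refl
hanging-decomp (node l r) (there m)   | yes _ = hanging-decomp r m
hanging-decomp (node l r) (here refl) | no _  = r , refl
hanging-decomp (node l r) (there m)   | no _  = hanging-decomp l m

nodes-are-decomps : ∀ {p q} → IsDecomp q → p ∈PD q → IsDecomp p
nodes-are-decomps isDecomp      here          = isDecomp
nodes-are-decomps (t , refl) (child m p∈q) =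
  nodes-are-decomps (hanging-decomp t m) p∈q

decomp-has-right : ∀ t → children (decomp t) ≢ [] →
                   Any IsRight (children (decomp t))
decomp-has-right leaf       nonempty = ⊥-elim (nonempty refl)
decomp-has-right (node l r) _        = hanging-has-right l r

mainTheorem2 : (T : Trie) →
    ((u : Trie) → u ⊑ T → Internal u → last (heavyPath u) ≡ just left)
    × ((p : PD) → p ∈PD decomp T → children p ≢ [] →
    Any (λ c → proj₁ c ≡ right) (children p))
mainTheorem2 T = endsLeft , hasRight
  where
  -- Part 1 holds for every internal node, whether or not it lies in T.
  endsLeft : (u : Trie) → u ⊑ T → Internal u → last (heavyPath u) ≡ just left
  endsLeft _ _ (internal l r) = heavyPath-ends-left l r

  hasRight : (p : PD) → p ∈PD decomp T → children p ≢ [] →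
             Any IsRight (children p)
  hasRight p p∈T with nodes-are-decomps (T , refl) p∈T
  ... | t , refl = decomp-has-right t
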